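{- Let $B(t,x)=\sum_T t^{\mathrm{da}(T)}x^{|T|}$, where the sum is over all binary trees $T$ (including the empty tree), $|T|$ is the number of nodes, and $\mathrm{da}(T)$ is the degree of asymmetry. Then $$B(t,x)=1+\frac{1-\sqrt{1+4x\left(x-\frac{1-\sqrt{1-4tx}}{t}\right)}}{2x}.$$
   Context: A binary tree is a rooted tree in which each node has at most two children, each designated as left child or right child. The address of a node is the word over $\{L,R\}$ recording the sequence of left/right children along the path from the root to the node (the root has the empty address); its complement is obtained by swapping $L$ and $R$. Two nodes are mirror images if their addresses are complements of each other (so the root is its own mirror image). The degree of asymmetry $\mathrm{da}(T)$ is the number of nodes of $T$ that are not mirror images of any node in $T$. -}

module Defs where

open import Data.Nat as ℕ using (ℕ; zero; suc; _∸_)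
open import Data.Integer as ℤ using (ℤ; +_)
open import Data.List using (List; []; _∷_; _++_; map; concatMap; length; filter; upTo; sum)
open import Data.List.Relation.Unary.Any using (any?)
open import Data.List.Properties using (≡-dec)
open import Relation.Nullary using (yes; no; ¬?)
open import Relation.Binary.PropositionalEquality using (_≡_; refl)
open import Relation.Binary.Definitions using (DecidableEquality)

-- Binary trees (leaf = the empty tree)

data Tree : Set where
  leaf : Tree
  node : Tree → Tree → Tree

size : Tree → ℕ
size leaf       = 0
size (node l r) = suc (size l ℕ.+ size r)

data Dir : Set where
  L R : Dir

_≟D_ : DecidableEquality Dir
L ≟D L = yes refl
L ≟D R = no (λ ())
R ≟D L = no (λ ())
R ≟D R = yes refl

Address : Set
Address = List Dir

_≟A_ : DecidableEquality Address
_≟A_ = ≡-dec _≟D_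

flip : Dir → Dir
flip L = R
flip R = L

complement : Address → Address
complement = map flip

addresses : Tree → List Address
addresses leaf       = []
addresses (node l r) = [] ∷ (map (L ∷_) (addresses l) ++ map (R ∷_) (addresses r))

da : Tree → ℕ
da T = length (filter (λ a → ¬? (any? (λ b → complement a ≟A b) (addresses T))) (addresses T))

-- all binary trees of height ≤ d (each listed exactly once)
treesH : ℕ → List Tree
treesH zero    = leaf ∷ []
treesH (suc d) = leaf ∷ concatMap (λ l → map (node l) (treesH d)) (treesH d)

-- all binary trees with exactly n nodes (a tree with n nodes has height ≤ n)
trees : ℕ → List Tree
trees n = filter (λ T → size T ℕ.≟ n) (treesH n)

-- Formal power series in two variables t, x with integer coefficients.
-- f k n is the coefficient of t^k x^n.

PS : Set
PS = ℕ → ℕ → ℤ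

infix 4 _≈_
_≈_ : PS → PS → Set
f ≈ g = ∀ k n → f k n ≡ g k n

infixl 6 _⊕_ _⊖_
infixl 7 _⊛_

_⊕_ : PS → PS → PS
(f ⊕ g) k n = f k n ℤ.+ g k n

_⊖_ : PS → PS → PS
(f ⊖ g) k n = f k n ℤ.- g k n

_⊛_ : PS → PS → PS
(f ⊛ g) k n = Data.List.foldr ℤ._+_ (+ 0)
  (map (λ i → Data.List.foldr ℤ._+_ (+ 0)
     (map (λ j → f i j ℤ.* g (k ∸ i) (n ∸ j)) (upTo (suc n)))) (upTo (suc k)))

mono : ℤ → ℕ → ℕ → PS
mono c a b k n with a ℕ.≟ k | b ℕ.≟ n
... | yes _ | yes _ = c
... | _     | _     = + 0

𝟙 𝕥 𝕩 : PS
𝟙 = mono (+ 1) 0 0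
𝕥 = mono (+ 1) 1 0
𝕩 = mono (+ 1) 0 1

const : ℤ → PS
const c = mono c 0 0

B : PS
B k n = + length (filter (λ T → da T ℕ.≟ k) (trees n))

{-# OPTIONS --safe #-}
-- A nonempty tree is node l r, and da (node l r) counts the nodes of l without a mirror image
-- in r plus those of r without one in l.  Splitting l and r once more at their roots, this pair
-- count becomes the sum of the counts for (l₁ , r₂) and (l₂ , r₁), while a leaf on one side makes
-- every node of the other side unmatched.  Hence, with C = Σ (tx)^|T| the Catalan series and
-- D = B − 1,
--   C = 1 + tx C²   and   D = x (2C − 1) + x D².
-- So Q = 1 − 2txC, W = 2xC and R = 1 − 2xD satisfy Q² = 1 − 4tx, tW = 1 − Q and
-- R² = 1 − 4xD + 4x²D² = 1 + 4x(x − W), and 2x(B − 1) = 1 − R.  Conversely a series with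
-- constant term 1 is determined by its square (if F² = G² then (F − G)(F + G) = 0, and F + G has
-- constant term 2), and W by tW, so these equations have no other solutions.
module Submission where

open import Defs
open import Data.Integer using (+_; -_)
open import Data.Product using (Σ; _×_; _,_)
open import Relation.Binary.PropositionalEquality using (_≡_)

open import Data.Bool using (Bool; true; false; not; _∨_)
open import Data.Bool.Properties using (∨-assoc; ∨-identityʳ)
open import Data.Integer as ℤ using (ℤ; _+_; _*_; _-_)
import Data.Integer.Properties as ℤ
open import Data.Integer.Tactic.RingSolver using (solve-∀)
open import Data.List using (List; []; _∷_; _++_; map; concatMap; filter; foldr; length; upTo; cartesianProduct)
open import Data.List.Membership.Propositional using (_∈_)
open import Data.List.Membership.Propositional.Properties using (∈-upTo⁻)
open import Data.List.Properties using (map-upTo; upTo-∷ʳ)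
open import Data.List.Relation.Unary.Any using (here; there; any?)
open import Data.Nat as ℕ using (ℕ; zero; suc; _∸_; _≤_; _<_; z≤n; s≤s; _≡ᵇ_)
import Data.Nat.Properties as ℕ
import Data.Nat.Tactic.RingSolver as ℕ-Solver
open import Data.Product using (proj₁; proj₂)
open import Data.Sum using (inj₁; inj₂)
open import Function using (_∘_)
open import Relation.Binary.PropositionalEquality
  using (refl; sym; trans; cong; cong₂; _≢_; module ≡-Reasoning)
open import Relation.Nullary using (does; yes; no; ¬?; contradiction)
open import Relation.Unary using (Decidable)

⟦_⟧ : Bool → ℤ
⟦ true  ⟧ = + 1
⟦ false ⟧ = + 0

-- Via ≡ᵇ, so that ⟦ does (a ℕ.≟ b) ⟧, which filtering with ℕ._≟_ produces, reduces to δ a b.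
δ : ℕ → ℕ → ℤ
δ a b = ⟦ a ≡ᵇ b ⟧

δ-diag : ∀ a → δ a a ≡ + 1
δ-diag zero    = refl
δ-diag (suc a) = δ-diag a

δ-≢ : ∀ {a b} → a ≢ b → δ a b ≡ + 0
δ-≢ {zero}  {zero}  a≢b = contradiction refl a≢b
δ-≢ {zero}  {suc b} _   = refl
δ-≢ {suc a} {zero}  _   = refl
δ-≢ {suc a} {suc b} a≢b = δ-≢ (a≢b ∘ cong suc)

δ-> : ∀ {a b} → b < a → δ a b ≡ + 0
δ-> b<a = δ-≢ (λ a≡b → ℕ.<-irrefl (sym a≡b) b<a)

-- Finite sums

∑ : ∀ {A : Set} → List A → (A → ℤ) → ℤ
∑ xs f = foldr _+_ (+ 0) (map f xs)

syntax ∑ xs (λ x → e) = ∑[ x ∈ xs ] e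

module _ {A : Set} where

  ∑-cong : ∀ (xs : List A) {f g : A → ℤ} → (∀ {x} → x ∈ xs → f x ≡ g x) → ∑ xs f ≡ ∑ xs g
  ∑-cong []       f≗g = refl
  ∑-cong (x ∷ xs) f≗g = cong₂ _+_ (f≗g (here refl)) (∑-cong xs (f≗g ∘ there))

  ∑-zero : ∀ (xs : List A) {f : A → ℤ} → (∀ {x} → x ∈ xs → f x ≡ + 0) → ∑ xs f ≡ + 0
  ∑-zero []       f≗0 = refl
  ∑-zero (x ∷ xs) f≗0 = cong₂ _+_ (f≗0 (here refl)) (∑-zero xs (f≗0 ∘ there))

  ∑-distrib-+ : ∀ (xs : List A) (f g : A → ℤ) → ∑[ x ∈ xs ] (f x + g x) ≡ ∑ xs f + ∑ xs g
  ∑-distrib-+ []       f g = refl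
  ∑-distrib-+ (x ∷ xs) f g = trans (cong (_+_ (f x + g x)) (∑-distrib-+ xs f g)) (interchange (f x) (g x) (∑ xs f) (∑ xs g))
    where
    interchange : ∀ a b c d → (a + b) + (c + d) ≡ (a + c) + (b + d)
    interchange = solve-∀

  ∑-distrib-- : ∀ (xs : List A) (f g : A → ℤ) → ∑[ x ∈ xs ] (f x - g x) ≡ ∑ xs f - ∑ xs g
  ∑-distrib-- []       f g = refl
  ∑-distrib-- (x ∷ xs) f g = trans (cong (_+_ (f x - g x)) (∑-distrib-- xs f g)) (interchange (f x) (g x) (∑ xs f) (∑ xs g))
    where
    interchange : ∀ a b c d → (a - b) + (c - d) ≡ (a + c) - (b + d)
    interchange = solve-∀

  *-distribˡ-∑ : ∀ c (xs : List A) (f : A → ℤ) → c * ∑ xs f ≡ ∑[ x ∈ xs ] (c * f x)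
  *-distribˡ-∑ c []       f = ℤ.*-zeroʳ c
  *-distribˡ-∑ c (x ∷ xs) f = trans (ℤ.*-distribˡ-+ c (f x) _) (cong (_+_ (c * f x)) (*-distribˡ-∑ c xs f))

  *-distribʳ-∑ : ∀ c (xs : List A) (f : A → ℤ) → ∑ xs f * c ≡ ∑[ x ∈ xs ] (f x * c)
  *-distribʳ-∑ c xs f = trans (ℤ.*-comm _ c)
    (trans (*-distribˡ-∑ c xs f) (∑-cong xs (λ {x} _ → ℤ.*-comm c (f x))))

  ∑-++ : ∀ (xs ys : List A) (f : A → ℤ) → ∑ (xs ++ ys) f ≡ ∑ xs f + ∑ ys f
  ∑-++ []       ys f = sym (ℤ.+-identityˡ _)
  ∑-++ (x ∷ xs) ys f = trans (cong (_+_ (f x)) (∑-++ xs ys f)) (sym (ℤ.+-assoc (f x) _ _))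

  ∑-map : ∀ {B : Set} (g : B → A) (xs : List B) (f : A → ℤ) → ∑ (map g xs) f ≡ ∑[ x ∈ xs ] f (g x)
  ∑-map g []       f = refl
  ∑-map g (x ∷ xs) f = cong (_+_ (f (g x))) (∑-map g xs f)

  ∑-concatMap : ∀ {B : Set} (g : B → List A) (xs : List B) (f : A → ℤ) →
                ∑ (concatMap g xs) f ≡ ∑[ x ∈ xs ] ∑ (g x) f
  ∑-concatMap g []       f = refl
  ∑-concatMap g (x ∷ xs) f =
    trans (∑-++ (g x) (concatMap g xs) f) (cong (_+_ (∑ (g x) f)) (∑-concatMap g xs f))

  ∑-filter : ∀ {P : A → Set} (P? : Decidable P) (xs : List A) (f : A → ℤ) →
             ∑ (filter P? xs) f ≡ ∑[ x ∈ xs ] (⟦ does (P? x) ⟧ * f x)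
  ∑-filter P? []       f = refl
  ∑-filter P? (x ∷ xs) f with does (P? x)
  ... | true  = cong₂ _+_ (sym (ℤ.*-identityˡ (f x))) (∑-filter P? xs f)
  ... | false = trans (∑-filter P? xs f) (sym (ℤ.+-identityˡ _))

  length-filter-∑ : ∀ {P : A → Set} (P? : Decidable P) (xs : List A) →
                    + length (filter P? xs) ≡ ∑[ x ∈ xs ] ⟦ does (P? x) ⟧
  length-filter-∑ P? []       = refl
  length-filter-∑ P? (x ∷ xs) with does (P? x)
  ... | true  = trans (ℤ.pos-+ 1 _) (cong (_+_ (+ 1)) (length-filter-∑ P? xs))
  ... | false = trans (length-filter-∑ P? xs) (sym (ℤ.+-identityˡ _))

∑-comm : ∀ {A B : Set} (xs : List A) (ys : List B) (f : A → B → ℤ) →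
         ∑[ x ∈ xs ] ∑[ y ∈ ys ] f x y ≡ ∑[ y ∈ ys ] ∑[ x ∈ xs ] f x y
∑-comm []       ys f = sym (∑-zero ys (λ _ → refl))
∑-comm (x ∷ xs) ys f = trans (cong (_+_ (∑ ys (f x))) (∑-comm xs ys f)) (sym (∑-distrib-+ ys (f x) _))

∑-*-∑ : ∀ {A B : Set} (xs : List A) (ys : List B) (f : A → ℤ) (g : B → ℤ) →
        ∑ xs f * ∑ ys g ≡ ∑[ x ∈ xs ] ∑[ y ∈ ys ] (f x * g y)
∑-*-∑ xs ys f g = trans (*-distribʳ-∑ (∑ ys g) xs f) (∑-cong xs (λ {x} _ → *-distribˡ-∑ (f x) ys g))

∑-cartesianProduct : ∀ {A B : Set} (xs : List A) (ys : List B) (f : A × B → ℤ) →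
                     ∑ (cartesianProduct xs ys) f ≡ ∑[ x ∈ xs ] ∑[ y ∈ ys ] f (x , y)
∑-cartesianProduct []       ys f = refl
∑-cartesianProduct (x ∷ xs) ys f = trans (∑-++ (map (x ,_) ys) _ f)
  (cong₂ _+_ (∑-map (x ,_) ys f) (∑-cartesianProduct xs ys f))

∑-upTo-suc : ∀ n (f : ℕ → ℤ) → ∑[ i ∈ upTo (suc n) ] f i ≡ f 0 + ∑[ i ∈ upTo n ] f (suc i)
∑-upTo-suc n f = cong (_+_ (f 0)) (trans (cong (λ is → ∑ is f) (sym (map-upTo suc n))) (∑-map suc (upTo n) f))

∑-upTo-∷ʳ : ∀ n (f : ℕ → ℤ) → ∑[ i ∈ upTo (suc n) ] f i ≡ ∑[ i ∈ upTo n ] f i + f n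
∑-upTo-∷ʳ n f = trans (cong (λ is → ∑ is f) (sym (upTo-∷ʳ n)))
  (trans (∑-++ (upTo n) (n ∷ []) f) (cong (_+_ (∑ (upTo n) f)) (ℤ.+-identityʳ (f n))))

∑-upTo-cong : ∀ n {f g : ℕ → ℤ} → (∀ {i} → i < n → f i ≡ g i) → ∑ (upTo n) f ≡ ∑ (upTo n) g
∑-upTo-cong n f≗g = ∑-cong (upTo n) (f≗g ∘ ∈-upTo⁻)

∑-upTo-reverse : ∀ k (f : ℕ → ℤ) → ∑[ i ∈ upTo (suc k) ] f i ≡ ∑[ i ∈ upTo (suc k) ] f (k ∸ i)
∑-upTo-reverse zero    f = refl
∑-upTo-reverse (suc k) f = begin
  ∑ (upTo (suc (suc k))) f                               ≡⟨ ∑-upTo-∷ʳ (suc k) f ⟩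
  ∑ (upTo (suc k)) f + f (suc k)                         ≡⟨ cong (_+ f (suc k)) (∑-upTo-reverse k f) ⟩
  ∑[ i ∈ upTo (suc k) ] f (k ∸ i) + f (suc k)            ≡⟨ ℤ.+-comm _ (f (suc k)) ⟩
  f (suc k) + ∑[ i ∈ upTo (suc k) ] f (k ∸ i)            ≡⟨ sym (∑-upTo-suc (suc k) (λ i → f (suc k ∸ i))) ⟩
  ∑[ i ∈ upTo (suc (suc k)) ] f (suc k ∸ i)              ∎
  where open ≡-Reasoning

∑-upTo-last : ∀ k (f : ℕ → ℤ) → (∀ {i} → i < k → f i ≡ + 0) → ∑ (upTo (suc k)) f ≡ f k
∑-upTo-last k f below = trans (∑-upTo-∷ʳ k f)
  (trans (cong (_+ f k) (∑-zero (upTo k) (below ∘ ∈-upTo⁻))) (ℤ.+-identityˡ (f k)))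

∑□ : ℕ → ℕ → (ℕ → ℕ → ℤ) → ℤ
∑□ k n F = ∑[ i ∈ upTo (suc k) ] ∑[ j ∈ upTo (suc n) ] F i j

∑□-cong : ∀ k n {F G : ℕ → ℕ → ℤ} →
          (∀ {i j} → i ≤ k → j ≤ n → F i j ≡ G i j) → ∑□ k n F ≡ ∑□ k n G
∑□-cong k n F≗G =
  ∑-upTo-cong (suc k) (λ i<1+k → ∑-upTo-cong (suc n) (λ j<1+n → F≗G (ℕ.≤-pred i<1+k) (ℕ.≤-pred j<1+n)))

∑□-distrib-+ : ∀ k n (F G : ℕ → ℕ → ℤ) → ∑□ k n (λ i j → F i j + G i j) ≡ ∑□ k n F + ∑□ k n G
∑□-distrib-+ k n F G =
  trans (∑-upTo-cong (suc k) (λ {i} _ → ∑-distrib-+ (upTo (suc n)) (F i) (G i)))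
        (∑-distrib-+ (upTo (suc k)) (λ i → ∑ (upTo (suc n)) (F i)) (λ i → ∑ (upTo (suc n)) (G i)))

∑□-distrib-- : ∀ k n (F G : ℕ → ℕ → ℤ) → ∑□ k n (λ i j → F i j - G i j) ≡ ∑□ k n F - ∑□ k n G
∑□-distrib-- k n F G =
  trans (∑-upTo-cong (suc k) (λ {i} _ → ∑-distrib-- (upTo (suc n)) (F i) (G i)))
        (∑-distrib-- (upTo (suc k)) (λ i → ∑ (upTo (suc n)) (F i)) (λ i → ∑ (upTo (suc n)) (G i)))

*-distribˡ-∑□ : ∀ c k n (F : ℕ → ℕ → ℤ) → c * ∑□ k n F ≡ ∑□ k n (λ i j → c * F i j)
*-distribˡ-∑□ c k n F =
  trans (*-distribˡ-∑ c (upTo (suc k)) (λ i → ∑ (upTo (suc n)) (F i)))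
        (∑-upTo-cong (suc k) (λ {i} _ → *-distribˡ-∑ c (upTo (suc n)) (F i)))

∑□-∑ : ∀ {X : Set} k n (xs : List X) (F : X → ℕ → ℕ → ℤ) →
       ∑□ k n (λ i j → ∑[ x ∈ xs ] F x i j) ≡ ∑[ x ∈ xs ] ∑□ k n (F x)
∑□-∑ k n xs F = trans
  (∑-cong (upTo (suc k)) (λ {i} _ → ∑-comm (upTo (suc n)) xs (λ j x → F x i j)))
  (∑-comm (upTo (suc k)) xs (λ i x → ∑[ j ∈ upTo (suc n) ] F x i j))

-- Formal power series

shift : ℕ → (ℕ → ℤ) → ℕ → ℤ
shift zero    h k       = h k
shift (suc a) h zero    = + 0
shift (suc a) h (suc k) = shift a h k

shift-cong : ∀ a {h h′ : ℕ → ℤ} → (∀ i → h i ≡ h′ i) → ∀ k → shift a h k ≡ shift a h′ k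
shift-cong zero    h≗h′ k       = h≗h′ k
shift-cong (suc a) h≗h′ zero    = refl
shift-cong (suc a) h≗h′ (suc k) = shift-cong a h≗h′ k

shift-zip : ∀ a (φ : ℤ → ℤ → ℤ) → φ (+ 0) (+ 0) ≡ + 0 →
            ∀ h h′ k → shift a (λ i → φ (h i) (h′ i)) k ≡ φ (shift a h k) (shift a h′ k)
shift-zip zero    φ φ0≡0 h h′ k       = refl
shift-zip (suc a) φ φ0≡0 h h′ zero    = sym φ0≡0
shift-zip (suc a) φ φ0≡0 h h′ (suc k) = shift-zip a φ φ0≡0 h h′ k

shift-*ʳ : ∀ a (h : ℕ → ℤ) c k → shift a h k * c ≡ shift a (λ i → h i * c) k
shift-*ʳ a h c k = sym (shift-zip a (λ z _ → z * c) refl h h k)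

shift-∑ : ∀ {A : Set} a (xs : List A) (h : A → ℕ → ℤ) k →
          ∑[ x ∈ xs ] shift a (h x) k ≡ shift a (λ i → ∑[ x ∈ xs ] h x i) k
shift-∑ zero    xs h k       = refl
shift-∑ (suc a) xs h zero    = ∑-zero xs (λ _ → refl)
shift-∑ (suc a) xs h (suc k) = shift-∑ a xs h k

δ-convolution : ∀ a (h : ℕ → ℤ) k → ∑[ i ∈ upTo (suc k) ] (δ a i * h (k ∸ i)) ≡ shift a h k
δ-convolution zero    h k       = begin
  ∑[ i ∈ upTo (suc k) ] (δ 0 i * h (k ∸ i))
    ≡⟨ ∑-upTo-suc k (λ i → δ 0 i * h (k ∸ i)) ⟩
  + 1 * h k + ∑[ i ∈ upTo k ] (+ 0)
    ≡⟨ cong₂ _+_ (ℤ.*-identityˡ (h k)) (∑-zero (upTo k) (λ _ → refl)) ⟩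
  h k + + 0
    ≡⟨ ℤ.+-identityʳ (h k) ⟩
  h k
    ∎
  where open ≡-Reasoning
δ-convolution (suc a) h zero    = refl
δ-convolution (suc a) h (suc k) =
  trans (∑-upTo-suc (suc k) (λ i → δ (suc a) i * h (suc k ∸ i)))
        (trans (ℤ.+-identityˡ _) (δ-convolution a h k))

shift-convolution : ∀ a (H : ℕ → ℕ → ℤ) k →
                  ∑[ i ∈ upTo (suc k) ] shift a (λ i′ → H i′ (k ∸ i)) i
                  ≡ shift a (λ k′ → ∑[ i ∈ upTo (suc k′) ] H i (k′ ∸ i)) k
shift-convolution zero    H k       = refl
shift-convolution (suc a) H zero    = refl
shift-convolution (suc a) H (suc k) =
  trans (∑-upTo-suc (suc k) (λ i → shift (suc a) (λ i′ → H i′ (suc k ∸ i)) i))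
        (trans (ℤ.+-identityˡ _) (shift-convolution a H k))

shift-δ : ∀ a b k → shift a (δ b) k ≡ δ (a ℕ.+ b) k
shift-δ zero    b k       = refl
shift-δ (suc a) b zero    = refl
shift-δ (suc a) b (suc k) = shift-δ a b k

infixr 8 t^_x^_·_
infixr 7 _⊙_

t^_x^_·_ : ℕ → ℕ → PS → PS
(t^ a x^ b · f) k n = shift a (λ k′ → shift b (f k′) n) k

_⊙_ : ℤ → PS → PS
(c ⊙ f) k n = c * f k n

t^x^-zip : ∀ a b (φ : ℤ → ℤ → ℤ) → φ (+ 0) (+ 0) ≡ + 0 → ∀ f g k n →
           (t^ a x^ b · (λ k n → φ (f k n) (g k n))) k n ≡ φ ((t^ a x^ b · f) k n) ((t^ a x^ b · g) k n)
t^x^-zip a b φ φ0≡0 f g k n = trans (shift-cong a (λ k′ → shift-zip b φ φ0≡0 (f k′) (g k′) n) k)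
  (shift-zip a φ φ0≡0 (λ k′ → shift b (f k′) n) (λ k′ → shift b (g k′) n) k)

t^x^-cong : ∀ a b {f g} → f ≈ g → t^ a x^ b · f ≈ t^ a x^ b · g
t^x^-cong a b f≈g k n = shift-cong a (λ k′ → shift-cong b (f≈g k′) n) k

t^x^-⊕ : ∀ a b f g → t^ a x^ b · (f ⊕ g) ≈ t^ a x^ b · f ⊕ t^ a x^ b · g
t^x^-⊕ a b = t^x^-zip a b _+_ refl

t^x^-⊖ : ∀ a b f g → t^ a x^ b · (f ⊖ g) ≈ t^ a x^ b · f ⊖ t^ a x^ b · g
t^x^-⊖ a b = t^x^-zip a b _-_ refl

t^x^-⊙ : ∀ a b c f → t^ a x^ b · (c ⊙ f) ≈ c ⊙ t^ a x^ b · f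
t^x^-⊙ a b c f = t^x^-zip a b (λ z _ → c * z) (ℤ.*-zeroʳ c) f f

mono-δ : ∀ c a b k n → mono c a b k n ≡ c * (δ a k * δ b n)
mono-δ c a b k n with a ℕ.≟ k | b ℕ.≟ n
... | yes refl | yes refl =
  sym (trans (cong (c *_) (cong₂ _*_ (δ-diag a) (δ-diag b))) (ℤ.*-identityʳ c))
... | yes refl | no b≢n   =
  sym (trans (cong (λ z → c * (δ a a * z)) (δ-≢ b≢n)) (trans (cong (c *_) (ℤ.*-zeroʳ (δ a a))) (ℤ.*-zeroʳ c)))
... | no a≢k   | _        = sym (trans (cong (λ z → c * (z * δ b n)) (δ-≢ a≢k)) (ℤ.*-zeroʳ c))

mono-⊛ : ∀ c a b f → mono c a b ⊛ f ≈ c ⊙ t^ a x^ b · f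
mono-⊛ c a b f k n = begin
  ∑□ k n (λ i j → mono c a b i j * f (k ∸ i) (n ∸ j))
    ≡⟨ ∑□-cong k n (λ {i} {j} _ _ →
         trans (cong (_* f (k ∸ i) (n ∸ j)) (mono-δ c a b i j)) (reassoc c (δ a i) (δ b j) (f (k ∸ i) (n ∸ j)))) ⟩
  ∑□ k n (λ i j → c * (δ a i * (δ b j * f (k ∸ i) (n ∸ j))))
    ≡⟨ sym (*-distribˡ-∑□ c k n (λ i j → δ a i * (δ b j * f (k ∸ i) (n ∸ j)))) ⟩
  c * ∑□ k n (λ i j → δ a i * (δ b j * f (k ∸ i) (n ∸ j)))
    ≡⟨ cong (c *_) (∑-upTo-cong (suc k) (λ {i} _ →
         trans (sym (*-distribˡ-∑ (δ a i) (upTo (suc n)) (λ j → δ b j * f (k ∸ i) (n ∸ j))))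
               (cong (δ a i *_) (δ-convolution b (f (k ∸ i)) n)))) ⟩
  c * ∑[ i ∈ upTo (suc k) ] (δ a i * shift b (f (k ∸ i)) n)
    ≡⟨ cong (c *_) (δ-convolution a (λ k′ → shift b (f k′) n) k) ⟩
  c * shift a (λ k′ → shift b (f k′) n) k
    ∎
  where
  open ≡-Reasoning
  reassoc : ∀ c p q r → c * (p * q) * r ≡ c * (p * (q * r))
  reassoc = solve-∀

⊛-local : ∀ {f f′ g g′ : PS} k n →
          (∀ {i j} → i ≤ k → j ≤ n → f i j ≡ f′ i j) → (∀ {i j} → i ≤ k → j ≤ n → g i j ≡ g′ i j) →
          (f ⊛ g) k n ≡ (f′ ⊛ g′) k n
⊛-local k n f≗f′ g≗g′ =
  ∑□-cong k n (λ {i} {j} i≤k j≤n → cong₂ _*_ (f≗f′ i≤k j≤n) (g≗g′ (ℕ.m∸n≤m k i) (ℕ.m∸n≤m n j)))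

⊛-congʳ : ∀ {f f′ : PS} g → f ≈ f′ → f ⊛ g ≈ f′ ⊛ g
⊛-congʳ g f≈f′ k n = ⊛-local {g = g} k n (λ {i} {j} _ _ → f≈f′ i j) (λ _ _ → refl)

⊛-congˡ : ∀ f {g g′ : PS} → g ≈ g′ → f ⊛ g ≈ f ⊛ g′
⊛-congˡ f g≈g′ k n = ⊛-local {f = f} k n (λ _ _ → refl) (λ {i} {j} _ _ → g≈g′ i j)

⊛-comm : ∀ f g → f ⊛ g ≈ g ⊛ f
⊛-comm f g k n =
  trans (∑-upTo-reverse k (λ i → ∑[ j ∈ upTo (suc n) ] (f i j * g (k ∸ i) (n ∸ j))))
        (∑-upTo-cong (suc k) (λ {i} i<1+k →
          trans (∑-upTo-reverse n (λ j → f (k ∸ i) j * g (k ∸ (k ∸ i)) (n ∸ j)))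
                (∑-upTo-cong (suc n) (λ {j} j<1+n →
                  trans (cong₂ (λ i′ j′ → f (k ∸ i) (n ∸ j) * g i′ j′)
                               (ℕ.m∸[m∸n]≡n (ℕ.≤-pred i<1+k)) (ℕ.m∸[m∸n]≡n (ℕ.≤-pred j<1+n)))
                        (ℤ.*-comm (f (k ∸ i) (n ∸ j)) (g i j))))))

⊛-distribʳ-⊖ : ∀ f g h → (f ⊖ g) ⊛ h ≈ f ⊛ h ⊖ g ⊛ h
⊛-distribʳ-⊖ f g h k n =
  trans (∑□-cong k n (λ {i} {j} _ _ → *-distribʳ-- (f i j) (g i j) (h (k ∸ i) (n ∸ j))))
        (∑□-distrib-- k n (λ i j → f i j * h (k ∸ i) (n ∸ j)) (λ i j → g i j * h (k ∸ i) (n ∸ j)))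
  where
  *-distribʳ-- : ∀ a b c → (a - b) * c ≡ a * c - b * c
  *-distribʳ-- = solve-∀

⊛-distribˡ-⊕ : ∀ f g h → f ⊛ (g ⊕ h) ≈ f ⊛ g ⊕ f ⊛ h
⊛-distribˡ-⊕ f g h k n =
  trans (∑□-cong k n (λ {i} {j} _ _ → ℤ.*-distribˡ-+ (f i j) (g (k ∸ i) (n ∸ j)) (h (k ∸ i) (n ∸ j))))
        (∑□-distrib-+ k n (λ i j → f i j * g (k ∸ i) (n ∸ j)) (λ i j → f i j * h (k ∸ i) (n ∸ j)))

⊙-⊛ : ∀ c f g → (c ⊙ f) ⊛ g ≈ c ⊙ (f ⊛ g)
⊙-⊛ c f g k n =
  trans (∑□-cong k n (λ {i} {j} _ _ → ℤ.*-assoc c (f i j) (g (k ∸ i) (n ∸ j))))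
        (sym (*-distribˡ-∑□ c k n (λ i j → f i j * g (k ∸ i) (n ∸ j))))

shift-⊛ : ∀ a b f g → (t^ a x^ b · f) ⊛ g ≈ t^ a x^ b · (f ⊛ g)
shift-⊛ a b f g k n = begin
  ((t^ a x^ b · f) ⊛ g) k n
    ≡⟨ ∑-upTo-cong (suc k) (λ {i} _ → trans
         (∑-upTo-cong (suc n) (λ {j} _ → shift-*ʳ a (λ i′ → shift b (f i′) j) (g (k ∸ i) (n ∸ j)) i))
         (shift-∑ a (upTo (suc n)) (λ j i′ → shift b (f i′) j * g (k ∸ i) (n ∸ j)) i)) ⟩
  ∑[ i ∈ upTo (suc k) ] shift a (λ i′ → ∑[ j ∈ upTo (suc n) ] (shift b (f i′) j * g (k ∸ i) (n ∸ j))) i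
    ≡⟨ shift-convolution a (λ i′ m → ∑[ j ∈ upTo (suc n) ] (shift b (f i′) j * g m (n ∸ j))) k ⟩
  shift a (λ k′ → ∑[ i ∈ upTo (suc k′) ] ∑[ j ∈ upTo (suc n) ] (shift b (f i) j * g (k′ ∸ i) (n ∸ j))) k
    ≡⟨ shift-cong a (λ k′ → trans
         (∑-upTo-cong (suc k′) (λ {i} _ → trans
           (∑-upTo-cong (suc n) (λ {j} _ → shift-*ʳ b (f i) (g (k′ ∸ i) (n ∸ j)) j))
           (shift-convolution b (λ j′ m → f i j′ * g (k′ ∸ i) m) n)))
         (shift-∑ b (upTo (suc k′)) (λ i n′ → ∑[ j ∈ upTo (suc n′) ] (f i j * g (k′ ∸ i) (n′ ∸ j))) n)) k ⟩
  (t^ a x^ b · (f ⊛ g)) k n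
    ∎
  where open ≡-Reasoning

𝟙-⊛ : ∀ f → 𝟙 ⊛ f ≈ f
𝟙-⊛ f k n = trans (mono-⊛ (+ 1) 0 0 f k n) (ℤ.*-identityˡ (f k n))

monomial-shift : ∀ a b → mono (+ 1) a b ≈ t^ a x^ b · 𝟙
monomial-shift a b k n = trans (sym (𝟙-⊛ (mono (+ 1) a b) k n))
  (trans (⊛-comm 𝟙 (mono (+ 1) a b) k n) (trans (mono-⊛ (+ 1) a b 𝟙 k n) (ℤ.*-identityˡ _)))

scaled-monomial-⊛ : ∀ c a b g → const c ⊛ mono (+ 1) a b ⊛ g ≈ c ⊙ t^ a x^ b · g
scaled-monomial-⊛ c a b g k n = begin
  (const c ⊛ mono (+ 1) a b ⊛ g) k n    ≡⟨ ⊛-congʳ g (mono-⊛ c 0 0 (mono (+ 1) a b)) k n ⟩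
  ((c ⊙ mono (+ 1) a b) ⊛ g) k n        ≡⟨ ⊙-⊛ c (mono (+ 1) a b) g k n ⟩
  c * (mono (+ 1) a b ⊛ g) k n          ≡⟨ cong (c *_) (trans (mono-⊛ (+ 1) a b g k n) (ℤ.*-identityˡ _)) ⟩
  c * (t^ a x^ b · g) k n               ∎
  where open ≡-Reasoning

𝕥-⊛-injective : ∀ {f g} → 𝕥 ⊛ f ≈ 𝕥 ⊛ g → f ≈ g
𝕥-⊛-injective {f} {g} 𝕥f≈𝕥g k n = begin
  f k n                  ≡⟨ sym (ℤ.*-identityˡ (f k n)) ⟩
  + 1 * f k n            ≡⟨ sym (mono-⊛ (+ 1) 1 0 f (suc k) n) ⟩
  (𝕥 ⊛ f) (suc k) n      ≡⟨ 𝕥f≈𝕥g (suc k) n ⟩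
  (𝕥 ⊛ g) (suc k) n      ≡⟨ mono-⊛ (+ 1) 1 0 g (suc k) n ⟩
  + 1 * g k n            ≡⟨ ℤ.*-identityˡ (g k n) ⟩
  g k n                  ∎
  where open ≡-Reasoning

one-minus-⊛ : ∀ c a b f g → (𝟙 ⊖ c ⊙ t^ a x^ b · f) ⊛ g ≈ g ⊖ c ⊙ t^ a x^ b · (f ⊛ g)
one-minus-⊛ c a b f g k n = trans (⊛-distribʳ-⊖ 𝟙 (c ⊙ t^ a x^ b · f) g k n)
  (cong₂ _-_ (𝟙-⊛ g k n) (trans (⊙-⊛ c (t^ a x^ b · f) g k n) (cong (c *_) (shift-⊛ a b f g k n))))

⊛-leading : ∀ (E S : PS) k n → (∀ {i j} → i ℕ.+ j < k ℕ.+ n → E i j ≡ + 0) → (E ⊛ S) k n ≡ E k n * S 0 0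
⊛-leading E S k n E-below = begin
  (E ⊛ S) k n
    ≡⟨ ∑-upTo-last k (λ i → ∑[ j ∈ upTo (suc n) ] (E i j * S (k ∸ i) (n ∸ j))) (λ {i} i<k →
         ∑-zero (upTo (suc n)) (λ {j} j∈ →
           cong (_* S (k ∸ i) (n ∸ j)) (E-below (ℕ.+-mono-<-≤ i<k (ℕ.≤-pred (∈-upTo⁻ j∈)))))) ⟩
  ∑[ j ∈ upTo (suc n) ] (E k j * S (k ∸ k) (n ∸ j))
    ≡⟨ ∑-upTo-last n (λ j → E k j * S (k ∸ k) (n ∸ j)) (λ {j} j<n →
         cong (_* S (k ∸ k) (n ∸ j)) (E-below (ℕ.+-monoʳ-< k j<n))) ⟩
  E k n * S (k ∸ k) (n ∸ n)
    ≡⟨ cong₂ (λ i j → E k n * S i j) (ℕ.n∸n≡0 k) (ℕ.n∸n≡0 n) ⟩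
  E k n * S 0 0
    ∎
  where
  open ≡-Reasoning

square-root-unique : ∀ {F G : PS} → F ⊛ F ≈ G ⊛ G → F 0 0 + G 0 0 ≢ + 0 → F ≈ G
square-root-unique {F} {G} F²≈G² F₀+G₀≢0 k n =
  ℤ.i-j≡0⇒i≡j (F k n) (G k n) (vanishes (suc (k ℕ.+ n)) k n ℕ.≤-refl)
  where
  product-vanishes : ∀ k n → ((F ⊖ G) ⊛ (F ⊕ G)) k n ≡ + 0
  product-vanishes k n = begin
    ((F ⊖ G) ⊛ (F ⊕ G)) k n
      ≡⟨ ⊛-distribʳ-⊖ F G (F ⊕ G) k n ⟩
    (F ⊛ (F ⊕ G)) k n - (G ⊛ (F ⊕ G)) k n
      ≡⟨ cong₂ _-_ (⊛-distribˡ-⊕ F F G k n) (⊛-distribˡ-⊕ G F G k n) ⟩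
    ((F ⊛ F) k n + (F ⊛ G) k n) - ((G ⊛ F) k n + (G ⊛ G) k n)
      ≡⟨ cong₂ (λ a b → (a + b) - ((G ⊛ F) k n + (G ⊛ G) k n)) (F²≈G² k n) (⊛-comm F G k n) ⟩
    ((G ⊛ G) k n + (G ⊛ F) k n) - ((G ⊛ F) k n + (G ⊛ G) k n)
      ≡⟨ cancel ((G ⊛ G) k n) ((G ⊛ F) k n) ⟩
    + 0
      ∎
    where
    open ≡-Reasoning
    cancel : ∀ a b → (a + b) - (b + a) ≡ + 0
    cancel = solve-∀

  -- Induction on k + n: by ⊛-leading, product-vanishes says (F ⊖ G) k n * (F 0 0 + G 0 0) ≡ 0.
  vanishes : ∀ N k n → k ℕ.+ n < N → (F ⊖ G) k n ≡ + 0
  vanishes (suc N) k n k+n<1+N = ℤ.*-cancelʳ-≡ ((F ⊖ G) k n) (+ 0) (F 0 0 + G 0 0) {{ℤ.≢-nonZero F₀+G₀≢0}}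
    (trans (sym (⊛-leading (F ⊖ G) (F ⊕ G) k n (λ i+j<k+n →
                  vanishes N _ _ (ℕ.<-≤-trans i+j<k+n (ℕ.≤-pred k+n<1+N)))))
           (product-vanishes k n))

-- Mirror images

-- The number of nodes of S whose mirror image is not a node of T.
unmirrored : Tree → Tree → ℕ
unmirrored leaf       _          = 0
unmirrored (node l r) leaf       = size (node l r)
unmirrored (node l r) (node c d) = unmirrored l d ℕ.+ unmirrored r c

unmirrored-leaf : ∀ S → unmirrored S leaf ≡ size S
unmirrored-leaf leaf       = refl
unmirrored-leaf (node l r) = refl

asym : Tree → Tree → ℕ
asym l r = unmirrored l r ℕ.+ unmirrored r l

hasNode : Address → Tree → Bool
hasNode _       leaf       = false
hasNode []      (node _ _) = true
hasNode (L ∷ a) (node l _) = hasNode a l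
hasNode (R ∷ a) (node _ r) = hasNode a r

module _ {A : Set} {P : A → Set} (P? : Decidable P) where

  does-any?-++ : ∀ xs ys → does (any? P? (xs ++ ys)) ≡ does (any? P? xs) ∨ does (any? P? ys)
  does-any?-++ []       ys = refl
  does-any?-++ (x ∷ xs) ys = trans (cong (does (P? x) ∨_) (does-any?-++ xs ys)) (sym (∨-assoc (does (P? x)) _ _))

  does-any?-map : ∀ {B : Set} {Q : B → Set} (Q? : Decidable Q) (f : B → A) →
                  (∀ y → does (P? (f y)) ≡ does (Q? y)) → ∀ ys → does (any? P? (map f ys)) ≡ does (any? Q? ys)
  does-any?-map Q? f P∘f≐Q []       = refl
  does-any?-map Q? f P∘f≐Q (y ∷ ys) = cong₂ _∨_ (P∘f≐Q y) (does-any?-map Q? f P∘f≐Q ys)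

  does-any?-map-none : ∀ {B : Set} (f : B → A) → (∀ y → does (P? (f y)) ≡ false) →
                       ∀ ys → does (any? P? (map f ys)) ≡ false
  does-any?-map-none f none []       = refl
  does-any?-map-none f none (y ∷ ys) = cong₂ _∨_ (none y) (does-any?-map-none f none ys)

does-any?-addresses : ∀ c T → does (any? (c ≟A_) (addresses T)) ≡ hasNode c T
does-any?-addresses c       leaf       = refl
does-any?-addresses []      (node l r) = refl
does-any?-addresses (L ∷ c) (node l r) = begin
  does (any? ((L ∷ c) ≟A_) (map (L ∷_) (addresses l) ++ map (R ∷_) (addresses r)))
    ≡⟨ does-any?-++ ((L ∷ c) ≟A_) (map (L ∷_) (addresses l)) (map (R ∷_) (addresses r)) ⟩
  does (any? ((L ∷ c) ≟A_) (map (L ∷_) (addresses l))) ∨ does (any? ((L ∷ c) ≟A_) (map (R ∷_) (addresses r)))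
    ≡⟨ cong₂ _∨_ (does-any?-map ((L ∷ c) ≟A_) (c ≟A_) (L ∷_) (λ _ → refl) (addresses l))
                 (does-any?-map-none ((L ∷ c) ≟A_) (R ∷_) (λ _ → refl) (addresses r)) ⟩
  does (any? (c ≟A_) (addresses l)) ∨ false
    ≡⟨ trans (∨-identityʳ _) (does-any?-addresses c l) ⟩
  hasNode c l
    ∎
  where open ≡-Reasoning
does-any?-addresses (R ∷ c) (node l r) = begin
  does (any? ((R ∷ c) ≟A_) (map (L ∷_) (addresses l) ++ map (R ∷_) (addresses r)))
    ≡⟨ does-any?-++ ((R ∷ c) ≟A_) (map (L ∷_) (addresses l)) (map (R ∷_) (addresses r)) ⟩
  does (any? ((R ∷ c) ≟A_) (map (L ∷_) (addresses l))) ∨ does (any? ((R ∷ c) ≟A_) (map (R ∷_) (addresses r)))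
    ≡⟨ cong₂ _∨_ (does-any?-map-none ((R ∷ c) ≟A_) (L ∷_) (λ _ → refl) (addresses l))
                 (does-any?-map ((R ∷ c) ≟A_) (c ≟A_) (R ∷_) (λ _ → refl) (addresses r)) ⟩
  false ∨ does (any? (c ≟A_) (addresses r))
    ≡⟨ does-any?-addresses c r ⟩
  hasNode c r
    ∎
  where open ≡-Reasoning

∑-addresses-node : ∀ l r (f : Address → ℤ) →
  ∑ (addresses (node l r)) f ≡ f [] + (∑[ a ∈ addresses l ] f (L ∷ a) + ∑[ a ∈ addresses r ] f (R ∷ a))
∑-addresses-node l r f = cong (_+_ (f [])) (trans (∑-++ (map (L ∷_) (addresses l)) (map (R ∷_) (addresses r)) f)
  (cong₂ _+_ (∑-map (L ∷_) (addresses l) f) (∑-map (R ∷_) (addresses r) f)))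

∑-unmirrored : ∀ S T → ∑[ a ∈ addresses S ] ⟦ not (hasNode (complement a) T) ⟧ ≡ + unmirrored S T
∑-unmirrored leaf       T          = refl
∑-unmirrored (node l r) leaf       = begin
  ∑[ a ∈ addresses (node l r) ] ⟦ not (hasNode (complement a) leaf) ⟧
    ≡⟨ ∑-addresses-node l r (λ a → ⟦ not (hasNode (complement a) leaf) ⟧) ⟩
  + 1 + (∑[ a ∈ addresses l ] ⟦ true ⟧ + ∑[ a ∈ addresses r ] ⟦ true ⟧)
    ≡⟨ cong (_+_ (+ 1)) (cong₂ _+_ (∑-unmirrored l leaf) (∑-unmirrored r leaf)) ⟩
  + 1 + (+ unmirrored l leaf + + unmirrored r leaf)
    ≡⟨ cong (_+_ (+ 1)) (sym (ℤ.pos-+ (unmirrored l leaf) (unmirrored r leaf))) ⟩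
  + suc (unmirrored l leaf ℕ.+ unmirrored r leaf)
    ≡⟨ cong (λ m → + suc m) (cong₂ ℕ._+_ (unmirrored-leaf l) (unmirrored-leaf r)) ⟩
  + size (node l r)
    ∎
  where open ≡-Reasoning
∑-unmirrored (node l r) (node c d) = begin
  ∑[ a ∈ addresses (node l r) ] ⟦ not (hasNode (complement a) (node c d)) ⟧
    ≡⟨ ∑-addresses-node l r (λ a → ⟦ not (hasNode (complement a) (node c d)) ⟧) ⟩
  + 0 + (∑[ a ∈ addresses l ] ⟦ not (hasNode (complement a) d) ⟧
          + ∑[ a ∈ addresses r ] ⟦ not (hasNode (complement a) c) ⟧)
    ≡⟨ ℤ.+-identityˡ _ ⟩
  ∑[ a ∈ addresses l ] ⟦ not (hasNode (complement a) d) ⟧ + ∑[ a ∈ addresses r ] ⟦ not (hasNode (complement a) c) ⟧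
    ≡⟨ cong₂ _+_ (∑-unmirrored l d) (∑-unmirrored r c) ⟩
  + unmirrored l d + + unmirrored r c
    ≡⟨ sym (ℤ.pos-+ (unmirrored l d) (unmirrored r c)) ⟩
  + unmirrored (node l r) (node c d)
    ∎
  where open ≡-Reasoning

da-unmirrored : ∀ T → da T ≡ unmirrored T T
da-unmirrored T = ℤ.+-injective (begin
  + da T
    ≡⟨ length-filter-∑ (λ a → ¬? (any? (complement a ≟A_) (addresses T))) (addresses T) ⟩
  ∑[ a ∈ addresses T ] ⟦ not (does (any? (complement a ≟A_) (addresses T))) ⟧
    ≡⟨ ∑-cong (addresses T) (λ {a} _ → cong (⟦_⟧ ∘ not) (does-any?-addresses (complement a) T)) ⟩
  ∑[ a ∈ addresses T ] ⟦ not (hasNode (complement a) T) ⟧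
    ≡⟨ ∑-unmirrored T T ⟩
  + unmirrored T T
    ∎)
  where open ≡-Reasoning

da-node : ∀ l r → da (node l r) ≡ asym l r
da-node l r = da-unmirrored (node l r)

-- Generating functions of graded families of lists

∑-treesH-suc : ∀ d (f : Tree → ℤ) →
               ∑ (treesH (suc d)) f ≡ f leaf + ∑[ l ∈ treesH d ] ∑[ r ∈ treesH d ] f (node l r)
∑-treesH-suc d f = cong (_+_ (f leaf)) (trans
  (∑-concatMap (λ l → map (node l) (treesH d)) (treesH d) f)
  (∑-cong (treesH d) (λ {l} _ → ∑-map (node l) (treesH d) f)))

-- For e ≤ d, the list Xs d consists of the elements of Xs e and of elements of ν-size larger than e.
record Graded {X : Set} (Xs : ℕ → List X) (ν : X → ℕ) : Set where
  field
    ∑-truncate : ∀ {e d} → e ≤ d → (f : X → ℤ) → (∀ x → e < ν x → f x ≡ + 0) → ∑ (Xs d) f ≡ ∑ (Xs e) f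

open Graded

∑-treesH-step : ∀ d (f : Tree → ℤ) → (∀ T → d < size T → f T ≡ + 0) → ∑ (treesH (suc d)) f ≡ ∑ (treesH d) f
∑-treesH-step zero    f large = trans (∑-treesH-suc zero f)
  (cong (_+_ (f leaf)) (∑-zero (treesH 0) (λ {l} _ → ∑-zero (treesH 0) (λ {r} _ → large (node l r) (s≤s z≤n)))))
∑-treesH-step (suc d) f large = begin
  ∑ (treesH (suc (suc d))) f
    ≡⟨ ∑-treesH-suc (suc d) f ⟩
  f leaf + ∑[ l ∈ treesH (suc d) ] ∑[ r ∈ treesH (suc d) ] f (node l r)
    ≡⟨ cong (_+_ (f leaf)) (∑-cong (treesH (suc d)) (λ {l} _ → ∑-treesH-step d (f ∘ node l)
         (λ r d<|r| → large (node l r) (s≤s (ℕ.<-≤-trans d<|r| (ℕ.m≤n+m (size r) (size l))))))) ⟩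
  f leaf + ∑[ l ∈ treesH (suc d) ] ∑[ r ∈ treesH d ] f (node l r)
    ≡⟨ cong (_+_ (f leaf)) (∑-treesH-step d (λ l → ∑[ r ∈ treesH d ] f (node l r))
         (λ l d<|l| → ∑-zero (treesH d) (λ {r} _ →
           large (node l r) (s≤s (ℕ.<-≤-trans d<|l| (ℕ.m≤m+n (size l) (size r))))))) ⟩
  f leaf + ∑[ l ∈ treesH d ] ∑[ r ∈ treesH d ] f (node l r)
    ≡⟨ sym (∑-treesH-suc d f) ⟩
  ∑ (treesH (suc d)) f
    ∎
  where open ≡-Reasoning

treesH-graded : Graded treesH size
∑-truncate treesH-graded {e} {zero}  z≤n   f large = refl
∑-truncate treesH-graded {e} {suc d} e≤1+d f large with ℕ.m≤n⇒m<n∨m≡n e≤1+d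
... | inj₂ refl  = refl
... | inj₁ e<1+d = trans (∑-treesH-step d f (λ T d<|T| → large T (ℕ.≤-<-trans (ℕ.≤-pred e<1+d) d<|T|)))
                         (∑-truncate treesH-graded (ℕ.≤-pred e<1+d) f large)

cartesianProduct-graded : ∀ {X Y : Set} {Xs : ℕ → List X} {Ys : ℕ → List Y} {ν : X → ℕ} {ν′ : Y → ℕ} →
  Graded Xs ν → Graded Ys ν′ →
  Graded (λ d → cartesianProduct (Xs d) (Ys d)) (λ p → ν (proj₁ p) ℕ.+ ν′ (proj₂ p))
∑-truncate (cartesianProduct-graded {Xs = Xs} {Ys} {ν} {ν′} Xs-graded Ys-graded) {e} {d} e≤d f large = begin
  ∑ (cartesianProduct (Xs d) (Ys d)) f
    ≡⟨ ∑-cartesianProduct (Xs d) (Ys d) f ⟩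
  ∑[ x ∈ Xs d ] ∑[ y ∈ Ys d ] f (x , y)
    ≡⟨ ∑-cong (Xs d) (λ {x} _ → ∑-truncate Ys-graded e≤d (λ y → f (x , y))
         (λ y e<ν′y → large (x , y) (ℕ.<-≤-trans e<ν′y (ℕ.m≤n+m (ν′ y) (ν x))))) ⟩
  ∑[ x ∈ Xs d ] ∑[ y ∈ Ys e ] f (x , y)
    ≡⟨ ∑-truncate Xs-graded e≤d (λ x → ∑[ y ∈ Ys e ] f (x , y)) (λ x e<νx → ∑-zero (Ys e) (λ {y} _ →
         large (x , y) (ℕ.<-≤-trans e<νx (ℕ.m≤m+n (ν x) (ν′ y))))) ⟩
  ∑[ x ∈ Xs e ] ∑[ y ∈ Ys e ] f (x , y)
    ≡⟨ sym (∑-cartesianProduct (Xs e) (Ys e) f) ⟩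
  ∑ (cartesianProduct (Xs e) (Ys e)) f
    ∎
  where open ≡-Reasoning

gf : ∀ {X : Set} → List X → (X → ℕ) → (X → ℕ) → PS
gf xs κ ν k n = ∑[ x ∈ xs ] (δ (ν x) n * δ (κ x) k)

∑□-δ : ∀ a b a′ b′ k n →
  ∑□ k n (λ i j → (δ b j * δ a i) * (δ b′ (n ∸ j) * δ a′ (k ∸ i))) ≡ δ (b ℕ.+ b′) n * δ (a ℕ.+ a′) k
∑□-δ a b a′ b′ k n = begin
  ∑□ k n (λ i j → (δ b j * δ a i) * (δ b′ (n ∸ j) * δ a′ (k ∸ i)))
    ≡⟨ ∑□-cong k n (λ {i} {j} _ _ → regroup (δ b j) (δ a i) (δ b′ (n ∸ j)) (δ a′ (k ∸ i))) ⟩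
  ∑□ k n (λ i j → (δ a i * δ a′ (k ∸ i)) * (δ b j * δ b′ (n ∸ j)))
    ≡⟨ sym (∑-*-∑ (upTo (suc k)) (upTo (suc n))
              (λ i → δ a i * δ a′ (k ∸ i)) (λ j → δ b j * δ b′ (n ∸ j))) ⟩
  ∑[ i ∈ upTo (suc k) ] (δ a i * δ a′ (k ∸ i)) * ∑[ j ∈ upTo (suc n) ] (δ b j * δ b′ (n ∸ j))
    ≡⟨ cong₂ _*_ (trans (δ-convolution a (δ a′) k) (shift-δ a a′ k))
                 (trans (δ-convolution b (δ b′) n) (shift-δ b b′ n)) ⟩
  δ (a ℕ.+ a′) k * δ (b ℕ.+ b′) n
    ≡⟨ ℤ.*-comm (δ (a ℕ.+ a′) k) (δ (b ℕ.+ b′) n) ⟩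
  δ (b ℕ.+ b′) n * δ (a ℕ.+ a′) k
    ∎
  where
  open ≡-Reasoning
  regroup : ∀ p q r s → (p * q) * (r * s) ≡ (q * s) * (p * r)
  regroup = solve-∀

gf-⊛ : ∀ {X Y : Set} (xs : List X) (ys : List Y) κ ν κ′ ν′ k n →
       (gf xs κ ν ⊛ gf ys κ′ ν′) k n
       ≡ ∑[ x ∈ xs ] ∑[ y ∈ ys ] (δ (ν x ℕ.+ ν′ y) n * δ (κ x ℕ.+ κ′ y) k)
gf-⊛ xs ys κ ν κ′ ν′ k n = begin
  ∑□ k n (λ i j → gf xs κ ν i j * gf ys κ′ ν′ (k ∸ i) (n ∸ j))
    ≡⟨ ∑□-cong k n (λ {i} {j} _ _ →
         ∑-*-∑ xs ys (λ x → δ (ν x) j * δ (κ x) i) (λ y → δ (ν′ y) (n ∸ j) * δ (κ′ y) (k ∸ i))) ⟩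
  ∑□ k n (λ i j → ∑[ x ∈ xs ] ∑[ y ∈ ys ] term x y i j)
    ≡⟨ ∑□-∑ k n xs (λ x i j → ∑[ y ∈ ys ] term x y i j) ⟩
  ∑[ x ∈ xs ] ∑□ k n (λ i j → ∑[ y ∈ ys ] term x y i j)
    ≡⟨ ∑-cong xs (λ {x} _ → ∑□-∑ k n ys (term x)) ⟩
  ∑[ x ∈ xs ] ∑[ y ∈ ys ] ∑□ k n (term x y)
    ≡⟨ ∑-cong xs (λ {x} _ → ∑-cong ys (λ {y} _ → ∑□-δ (κ x) (ν x) (κ′ y) (ν′ y) k n)) ⟩
  ∑[ x ∈ xs ] ∑[ y ∈ ys ] (δ (ν x ℕ.+ ν′ y) n * δ (κ x ℕ.+ κ′ y) k)
    ∎
  where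
  open ≡-Reasoning
  term : _ → _ → ℕ → ℕ → ℤ
  term x y i j = (δ (ν x) j * δ (κ x) i) * (δ (ν′ y) (n ∸ j) * δ (κ′ y) (k ∸ i))

gradedGF : ∀ {X : Set} → (ℕ → List X) → (X → ℕ) → (X → ℕ) → PS
gradedGF Xs κ ν k n = gf (Xs n) κ ν k n

gradedGF-truncate : ∀ {X : Set} {Xs : ℕ → List X} {ν : X → ℕ} → Graded Xs ν →
                    ∀ κ {k n d} → n ≤ d → gradedGF Xs κ ν k n ≡ gf (Xs d) κ ν k n
gradedGF-truncate {ν = ν} Xs-graded κ {k} {n} n≤d =
  sym (∑-truncate Xs-graded n≤d (λ x → δ (ν x) n * δ (κ x) k) (λ x n<νx → cong (_* δ (κ x) k) (δ-> n<νx)))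

gradedGF-⊛ : ∀ {X Y : Set} {Xs : ℕ → List X} {Ys : ℕ → List Y} {ν : X → ℕ} {ν′ : Y → ℕ} →
  Graded Xs ν → Graded Ys ν′ → ∀ κ κ′ {k n} d → n ≤ d →
  (gradedGF Xs κ ν ⊛ gradedGF Ys κ′ ν′) k n
  ≡ ∑[ x ∈ Xs d ] ∑[ y ∈ Ys d ] (δ (ν x ℕ.+ ν′ y) n * δ (κ x ℕ.+ κ′ y) k)
gradedGF-⊛ {Xs = Xs} {Ys} {ν} {ν′} Xs-graded Ys-graded κ κ′ {k} {n} d n≤d = trans
  (⊛-local {f = gradedGF Xs κ ν} {gf (Xs d) κ ν} {gradedGF Ys κ′ ν′} {gf (Ys d) κ′ ν′} k n
    (λ {i} {j} _ j≤n → gradedGF-truncate Xs-graded κ {i} {j} {d} (ℕ.≤-trans j≤n n≤d))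
    (λ {i} {j} _ j≤n → gradedGF-truncate Ys-graded κ′ {i} {j} {d} (ℕ.≤-trans j≤n n≤d)))
  (gf-⊛ (Xs d) (Ys d) κ ν κ′ ν′ k n)

-- Binary trees counted by degree of asymmetry

catalan : PS
catalan = gradedGF treesH size size

pairSize pairAsym : Tree × Tree → ℕ
pairSize (l , r) = size l ℕ.+ size r
pairAsym (l , r) = asym l r

pairs : ℕ → List (Tree × Tree)
pairs d = cartesianProduct (treesH d) (treesH d)

pairs-graded : Graded pairs pairSize
pairs-graded = cartesianProduct-graded treesH-graded treesH-graded

asymGF : PS
asymGF = gradedGF pairs pairAsym pairSize

𝟙-vanishes-off-x⁰ : ∀ k n → 𝟙 k (suc n) ≡ + 0
𝟙-vanishes-off-x⁰ zero    n = refl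
𝟙-vanishes-off-x⁰ (suc k) n = refl

B-gradedGF : B ≈ gradedGF treesH da size
B-gradedGF k n = trans (length-filter-∑ (λ T → da T ℕ.≟ k) (filter (λ T → size T ℕ.≟ n) (treesH n)))
                       (∑-filter (λ T → size T ℕ.≟ n) (treesH n) (λ T → δ (da T) k))

B-nonempty : B ⊖ 𝟙 ≈ t^ 0 x^ 1 · asymGF
B-nonempty zero    zero    = refl
B-nonempty (suc k) zero    = refl
B-nonempty k       (suc m) = begin
  B k (suc m) - 𝟙 k (suc m)
    ≡⟨ cong₂ _-_ (B-gradedGF k (suc m)) (𝟙-vanishes-off-x⁰ k m) ⟩
  ∑[ T ∈ treesH (suc m) ] (δ (size T) (suc m) * δ (da T) k) - + 0
    ≡⟨ ℤ.+-identityʳ _ ⟩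
  ∑[ T ∈ treesH (suc m) ] (δ (size T) (suc m) * δ (da T) k)
    ≡⟨ ∑-treesH-suc m (λ T → δ (size T) (suc m) * δ (da T) k) ⟩
  + 0 + ∑[ l ∈ treesH m ] ∑[ r ∈ treesH m ] (δ (size l ℕ.+ size r) m * δ (da (node l r)) k)
    ≡⟨ ℤ.+-identityˡ _ ⟩
  ∑[ l ∈ treesH m ] ∑[ r ∈ treesH m ] (δ (size l ℕ.+ size r) m * δ (da (node l r)) k)
    ≡⟨ ∑-cong (treesH m) (λ {l} _ → ∑-cong (treesH m) (λ {r} _ →
         cong (λ a → δ (size l ℕ.+ size r) m * δ a k) (da-node l r))) ⟩
  ∑[ l ∈ treesH m ] ∑[ r ∈ treesH m ] (δ (size l ℕ.+ size r) m * δ (asym l r) k)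
    ≡⟨ sym (∑-cartesianProduct (treesH m) (treesH m) (λ p → δ (pairSize p) m * δ (pairAsym p) k)) ⟩
  asymGF k m
    ∎
  where open ≡-Reasoning

catalan-equation : catalan ≈ 𝟙 ⊕ t^ 1 x^ 1 · (catalan ⊛ catalan)
catalan-equation zero    zero    = refl
catalan-equation (suc k) zero    = refl
catalan-equation zero    (suc n) = ∑-zero (treesH (suc n)) (λ {T} _ → vanishes T)
  where
  vanishes : ∀ T → δ (size T) (suc n) * δ (size T) 0 ≡ + 0
  vanishes leaf       = refl
  vanishes (node l r) = ℤ.*-zeroʳ (δ (size l ℕ.+ size r) n)
catalan-equation (suc k) (suc n) = begin
  catalan (suc k) (suc n)
    ≡⟨ ∑-treesH-suc n (λ T → δ (size T) (suc n) * δ (size T) (suc k)) ⟩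
  + 0 + ∑[ l ∈ treesH n ] ∑[ r ∈ treesH n ] (δ (size l ℕ.+ size r) n * δ (size l ℕ.+ size r) k)
    ≡⟨ cong (_+_ (+ 0)) (sym (gradedGF-⊛ treesH-graded treesH-graded size size n ℕ.≤-refl)) ⟩
  + 0 + (catalan ⊛ catalan) k n
    ∎
  where open ≡-Reasoning

+-exchange : ∀ a b c d → (a ℕ.+ b) ℕ.+ (c ℕ.+ d) ≡ (a ℕ.+ d) ℕ.+ (b ℕ.+ c)
+-exchange = ℕ-Solver.solve-∀

asym-leafˡ : ∀ r → asym leaf r ≡ size r
asym-leafˡ = unmirrored-leaf

asym-leafʳ : ∀ l → asym l leaf ≡ size l
asym-leafʳ l = trans (ℕ.+-identityʳ (unmirrored l leaf)) (unmirrored-leaf l)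

asym-nodes : ∀ l₁ l₂ r₁ r₂ → asym (node l₁ l₂) (node r₁ r₂) ≡ asym l₁ r₂ ℕ.+ asym l₂ r₁
asym-nodes l₁ l₂ r₁ r₂ = +-exchange (unmirrored l₁ r₂) (unmirrored l₂ r₁) (unmirrored r₁ l₂) (unmirrored r₂ l₁)

pairTerm : ℕ → ℕ → Tree → Tree → ℤ
pairTerm k m l r = δ (size l ℕ.+ size r) m * δ (asym l r) k

∑-pairs-leafˡ : ∀ k m → ∑[ r ∈ treesH m ] pairTerm k m leaf r ≡ catalan k m
∑-pairs-leafˡ k m = ∑-cong (treesH m) (λ {r} _ → cong (λ a → δ (size r) m * δ a k) (asym-leafˡ r))

∑-pairs-leafʳ : ∀ k d →
  ∑[ l₁ ∈ treesH d ] ∑[ l₂ ∈ treesH d ] pairTerm k (suc d) (node l₁ l₂) leaf ≡ catalan k (suc d)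
∑-pairs-leafʳ k d = begin
  ∑[ l₁ ∈ treesH d ] ∑[ l₂ ∈ treesH d ] pairTerm k (suc d) (node l₁ l₂) leaf
    ≡⟨ sym (trans (∑-treesH-suc d (λ l → pairTerm k (suc d) l leaf)) (ℤ.+-identityˡ _)) ⟩
  ∑[ l ∈ treesH (suc d) ] pairTerm k (suc d) l leaf
    ≡⟨ ∑-cong (treesH (suc d)) (λ {l} _ →
         cong₂ (λ a b → δ a (suc d) * δ b k) (ℕ.+-identityʳ (size l)) (asym-leafʳ l)) ⟩
  catalan k (suc d)
    ∎
  where open ≡-Reasoning

∑-pairs-nodes : ∀ k d →
  ∑[ l₁ ∈ treesH d ] ∑[ l₂ ∈ treesH d ] ∑[ r₁ ∈ treesH d ] ∑[ r₂ ∈ treesH d ]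
    pairTerm k (suc d) (node l₁ l₂) (node r₁ r₂)
  ≡ (t^ 0 x^ 1 · t^ 0 x^ 1 · (asymGF ⊛ asymGF)) k (suc d)
∑-pairs-nodes k zero     = refl
∑-pairs-nodes k (suc d) = begin
  ∑[ l₁ ∈ Ts ] ∑[ l₂ ∈ Ts ] ∑[ r₁ ∈ Ts ] ∑[ r₂ ∈ Ts ] pairTerm k (suc (suc d)) (node l₁ l₂) (node r₁ r₂)
    ≡⟨ ∑-cong Ts (λ {l₁} _ → trans
         (∑-cong Ts (λ {l₂} _ → ∑-comm Ts Ts (λ r₁ r₂ → pairTerm k (suc (suc d)) (node l₁ l₂) (node r₁ r₂))))
         (∑-comm Ts Ts (λ l₂ r₂ → ∑[ r₁ ∈ Ts ] pairTerm k (suc (suc d)) (node l₁ l₂) (node r₁ r₂)))) ⟩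
  ∑[ l₁ ∈ Ts ] ∑[ r₂ ∈ Ts ] ∑[ l₂ ∈ Ts ] ∑[ r₁ ∈ Ts ] pairTerm k (suc (suc d)) (node l₁ l₂) (node r₁ r₂)
    ≡⟨ ∑-cong Ts (λ {l₁} _ → ∑-cong Ts (λ {r₂} _ → ∑-cong Ts (λ {l₂} _ → ∑-cong Ts (λ {r₁} _ →
         cong₂ _*_ (size-nodes l₁ l₂ r₁ r₂) (cong (λ a → δ a k) (asym-nodes l₁ l₂ r₁ r₂)))))) ⟩
  ∑[ l₁ ∈ Ts ] ∑[ r₂ ∈ Ts ] ∑[ l₂ ∈ Ts ] ∑[ r₁ ∈ Ts ]
      (δ ((size l₁ ℕ.+ size r₂) ℕ.+ (size l₂ ℕ.+ size r₁)) d * δ (asym l₁ r₂ ℕ.+ asym l₂ r₁) k)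
    ≡⟨ sym (trans (∑-cartesianProduct Ts Ts (λ p → ∑[ q ∈ pairs (suc d) ] product-term p q))
                  (∑-cong Ts (λ {l₁} _ → ∑-cong Ts (λ {r₂} _ →
                    ∑-cartesianProduct Ts Ts (product-term (l₁ , r₂)))))) ⟩
  ∑[ p ∈ pairs (suc d) ] ∑[ q ∈ pairs (suc d) ] product-term p q
    ≡⟨ sym (gradedGF-⊛ pairs-graded pairs-graded pairAsym pairAsym (suc d) (ℕ.n≤1+n d)) ⟩
  (asymGF ⊛ asymGF) k d
    ∎
  where
  open ≡-Reasoning
  Ts = treesH (suc d)
  product-term : Tree × Tree → Tree × Tree → ℤ
  product-term p q = δ (pairSize p ℕ.+ pairSize q) d * δ (pairAsym p ℕ.+ pairAsym q) k
  size-nodes : ∀ l₁ l₂ r₁ r₂ →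
    δ (size (node l₁ l₂) ℕ.+ size (node r₁ r₂)) (suc (suc d))
    ≡ δ ((size l₁ ℕ.+ size r₂) ℕ.+ (size l₂ ℕ.+ size r₁)) d
  size-nodes l₁ l₂ r₁ r₂ = cong (λ a → δ a (suc d))
    (trans (ℕ.+-suc (size l₁ ℕ.+ size l₂) (size r₁ ℕ.+ size r₂))
           (cong suc (+-exchange (size l₁) (size l₂) (size r₁) (size r₂))))

asymGF-equation : asymGF ≈ (+ 2 ⊙ catalan ⊖ 𝟙) ⊕ t^ 0 x^ 1 · t^ 0 x^ 1 · (asymGF ⊛ asymGF)
asymGF-equation zero    zero    = refl
asymGF-equation (suc k) zero    = refl
asymGF-equation k       (suc d) = begin
  asymGF k (suc d)
    ≡⟨ ∑-cartesianProduct Ts Ts (λ p → pairTerm k (suc d) (proj₁ p) (proj₂ p)) ⟩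
  ∑[ l ∈ Ts ] ∑[ r ∈ Ts ] pairTerm k (suc d) l r
    ≡⟨ ∑-treesH-suc d (λ l → ∑[ r ∈ Ts ] pairTerm k (suc d) l r) ⟩
  ∑[ r ∈ Ts ] pairTerm k (suc d) leaf r
    + ∑[ l₁ ∈ treesH d ] ∑[ l₂ ∈ treesH d ] ∑[ r ∈ Ts ] pairTerm k (suc d) (node l₁ l₂) r
    ≡⟨ cong₂ _+_ (∑-pairs-leafˡ k (suc d)) (∑-cong (treesH d) (λ {l₁} _ → ∑-cong (treesH d) (λ {l₂} _ →
         ∑-treesH-suc d (pairTerm k (suc d) (node l₁ l₂))))) ⟩
  catalan k (suc d) + ∑[ l₁ ∈ treesH d ] ∑[ l₂ ∈ treesH d ] (pairTerm k (suc d) (node l₁ l₂) leaf + nodes l₁ l₂)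
    ≡⟨ cong (_+_ (catalan k (suc d))) (trans
         (∑-cong (treesH d) (λ {l₁} _ →
           ∑-distrib-+ (treesH d) (λ l₂ → pairTerm k (suc d) (node l₁ l₂) leaf) (nodes l₁)))
         (∑-distrib-+ (treesH d) (λ l₁ → ∑[ l₂ ∈ treesH d ] pairTerm k (suc d) (node l₁ l₂) leaf)
                                 (λ l₁ → ∑[ l₂ ∈ treesH d ] nodes l₁ l₂))) ⟩
  catalan k (suc d) + (∑[ l₁ ∈ treesH d ] ∑[ l₂ ∈ treesH d ] pairTerm k (suc d) (node l₁ l₂) leaf
                        + ∑[ l₁ ∈ treesH d ] ∑[ l₂ ∈ treesH d ] nodes l₁ l₂)
    ≡⟨ cong (_+_ (catalan k (suc d))) (cong₂ _+_ (∑-pairs-leafʳ k d) (∑-pairs-nodes k d)) ⟩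
  catalan k (suc d) + (catalan k (suc d) + (t^ 0 x^ 1 · t^ 0 x^ 1 · (asymGF ⊛ asymGF)) k (suc d))
    ≡⟨ double (catalan k (suc d)) _ ⟩
  (+ 2 * catalan k (suc d) - + 0) + (t^ 0 x^ 1 · t^ 0 x^ 1 · (asymGF ⊛ asymGF)) k (suc d)
    ≡⟨ cong (λ u → (+ 2 * catalan k (suc d) - u) + (t^ 0 x^ 1 · t^ 0 x^ 1 · (asymGF ⊛ asymGF)) k (suc d))
            (sym (𝟙-vanishes-off-x⁰ k d)) ⟩
  (+ 2 * catalan k (suc d) - 𝟙 k (suc d)) + (t^ 0 x^ 1 · t^ 0 x^ 1 · (asymGF ⊛ asymGF)) k (suc d)
    ∎
  where
  open ≡-Reasoning
  Ts = treesH (suc d)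
  nodes : Tree → Tree → ℤ
  nodes l₁ l₂ = ∑[ r₁ ∈ treesH d ] ∑[ r₂ ∈ treesH d ] pairTerm k (suc d) (node l₁ l₂) (node r₁ r₂)
  double : ∀ c s → c + (c + s) ≡ (+ 2 * c - + 0) + s
  double = solve-∀

-- The square roots

i≡j-[j-i] : ∀ i j → i ≡ j - (j - i)
i≡j-[j-i] = solve-∀

Q₀ W₀ R₀ : PS
Q₀ = 𝟙 ⊖ + 2 ⊙ t^ 1 x^ 1 · catalan
W₀ = + 2 ⊙ t^ 0 x^ 1 · catalan
R₀ = 𝟙 ⊖ + 2 ⊙ t^ 0 x^ 1 · (B ⊖ 𝟙)

const⊛𝕥⊛𝕩 : ∀ c → const c ⊛ 𝕥 ⊛ 𝕩 ≈ c ⊙ t^ 1 x^ 1 · 𝟙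
const⊛𝕥⊛𝕩 c k n = trans (scaled-monomial-⊛ c 1 0 𝕩 k n) (cong (c *_) (t^x^-cong 1 0 (monomial-shift 0 1) k n))

Q₀-square : Q₀ ⊛ Q₀ ≈ 𝟙 ⊖ const (+ 4) ⊛ 𝕥 ⊛ 𝕩
Q₀-square k n = begin
  (Q₀ ⊛ Q₀) k n
    ≡⟨ one-minus-⊛ (+ 2) 1 1 catalan Q₀ k n ⟩
  u - + 2 * c - + 2 * tx (catalan ⊛ Q₀)
    ≡⟨ cong (λ z → u - + 2 * c - + 2 * z) (trans
         (t^x^-cong 1 1 (λ i j → trans (⊛-comm catalan Q₀ i j) (one-minus-⊛ (+ 2) 1 1 catalan catalan i j)) k n)
         (trans (t^x^-⊖ 1 1 catalan _ k n) (cong (_-_ c) (t^x^-⊙ 1 1 (+ 2) _ k n)))) ⟩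
  u - + 2 * c - + 2 * (c - + 2 * s)
    ≡⟨ cong (λ c → u - + 2 * c - + 2 * (c - + 2 * s))
         (trans (t^x^-cong 1 1 catalan-equation k n) (t^x^-⊕ 1 1 𝟙 _ k n)) ⟩
  u - + 2 * (o + s) - + 2 * ((o + s) - + 2 * s)
    ≡⟨ simplify u o s ⟩
  u - + 4 * o
    ≡⟨ cong (_-_ u) (sym (const⊛𝕥⊛𝕩 (+ 4) k n)) ⟩
  (𝟙 ⊖ const (+ 4) ⊛ 𝕥 ⊛ 𝕩) k n
    ∎
  where
  open ≡-Reasoning
  tx : PS → ℤ
  tx f = (t^ 1 x^ 1 · f) k n
  u = 𝟙 k n
  c = tx catalan
  o = tx 𝟙
  s = tx (t^ 1 x^ 1 · (catalan ⊛ catalan))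
  simplify : ∀ u o s → u - + 2 * (o + s) - + 2 * ((o + s) - + 2 * s) ≡ u - + 4 * o
  simplify = solve-∀

W₀-equation : 𝕥 ⊛ W₀ ≈ 𝟙 ⊖ Q₀
W₀-equation k n = begin
  (𝕥 ⊛ W₀) k n                        ≡⟨ mono-⊛ (+ 1) 1 0 W₀ k n ⟩
  + 1 * (t^ 1 x^ 0 · W₀) k n          ≡⟨ cong (+ 1 *_) (t^x^-⊙ 1 0 (+ 2) (t^ 0 x^ 1 · catalan) k n) ⟩
  + 1 * (+ 2 * c)                     ≡⟨ ℤ.*-identityˡ (+ 2 * c) ⟩
  + 2 * c                             ≡⟨ i≡j-[j-i] (+ 2 * c) (𝟙 k n) ⟩
  𝟙 k n - (𝟙 k n - + 2 * c)           ∎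
  where
  open ≡-Reasoning
  c = (t^ 1 x^ 1 · catalan) k n

nonempty-square : (B ⊖ 𝟙) ⊛ (B ⊖ 𝟙) ≈ t^ 0 x^ 1 · t^ 0 x^ 1 · (asymGF ⊛ asymGF)
nonempty-square k n = begin
  ((B ⊖ 𝟙) ⊛ (B ⊖ 𝟙)) k n
    ≡⟨ ⊛-congʳ (B ⊖ 𝟙) B-nonempty k n ⟩
  ((t^ 0 x^ 1 · asymGF) ⊛ (B ⊖ 𝟙)) k n
    ≡⟨ shift-⊛ 0 1 asymGF (B ⊖ 𝟙) k n ⟩
  (t^ 0 x^ 1 · (asymGF ⊛ (B ⊖ 𝟙))) k n
    ≡⟨ t^x^-cong 0 1 (λ i j → trans (⊛-congˡ asymGF B-nonempty i j)
         (trans (⊛-comm asymGF (t^ 0 x^ 1 · asymGF) i j) (shift-⊛ 0 1 asymGF asymGF i j))) k n ⟩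
  (t^ 0 x^ 1 · t^ 0 x^ 1 · (asymGF ⊛ asymGF)) k n
    ∎
  where open ≡-Reasoning

nonempty-equation : B ⊖ 𝟙 ≈ (W₀ ⊖ t^ 0 x^ 1 · 𝟙) ⊕ t^ 0 x^ 1 · ((B ⊖ 𝟙) ⊛ (B ⊖ 𝟙))
nonempty-equation k n = begin
  (B ⊖ 𝟙) k n
    ≡⟨ B-nonempty k n ⟩
  x· asymGF
    ≡⟨ t^x^-cong 0 1 asymGF-equation k n ⟩
  x· ((+ 2 ⊙ catalan ⊖ 𝟙) ⊕ t^ 0 x^ 1 · t^ 0 x^ 1 · (asymGF ⊛ asymGF))
    ≡⟨ t^x^-⊕ 0 1 (+ 2 ⊙ catalan ⊖ 𝟙) (t^ 0 x^ 1 · t^ 0 x^ 1 · (asymGF ⊛ asymGF)) k n ⟩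
  x· (+ 2 ⊙ catalan ⊖ 𝟙) + x· (t^ 0 x^ 1 · t^ 0 x^ 1 · (asymGF ⊛ asymGF))
    ≡⟨ cong₂ _+_ (trans (t^x^-⊖ 0 1 (+ 2 ⊙ catalan) 𝟙 k n) (cong (_- x· 𝟙) (t^x^-⊙ 0 1 (+ 2) catalan k n)))
                 (sym (t^x^-cong 0 1 nonempty-square k n)) ⟩
  (W₀ k n - x· 𝟙) + x· ((B ⊖ 𝟙) ⊛ (B ⊖ 𝟙))
    ∎
  where
  open ≡-Reasoning
  x· : PS → ℤ
  x· f = (t^ 0 x^ 1 · f) k n

R₀-square : R₀ ⊛ R₀ ≈ 𝟙 ⊕ const (+ 4) ⊛ 𝕩 ⊛ (𝕩 ⊖ W₀)
R₀-square k n = begin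
  (R₀ ⊛ R₀) k n
    ≡⟨ one-minus-⊛ (+ 2) 0 1 (B ⊖ 𝟙) R₀ k n ⟩
  u - + 2 * d - + 2 * x· ((B ⊖ 𝟙) ⊛ R₀)
    ≡⟨ cong (λ z → u - + 2 * d - + 2 * z) (trans
         (t^x^-cong 0 1 (λ i j → trans (⊛-comm (B ⊖ 𝟙) R₀ i j) (one-minus-⊛ (+ 2) 0 1 (B ⊖ 𝟙) (B ⊖ 𝟙) i j)) k n)
         (trans (t^x^-⊖ 0 1 (B ⊖ 𝟙) (+ 2 ⊙ t^ 0 x^ 1 · ((B ⊖ 𝟙) ⊛ (B ⊖ 𝟙))) k n)
                (cong (_-_ d) (t^x^-⊙ 0 1 (+ 2) (t^ 0 x^ 1 · ((B ⊖ 𝟙) ⊛ (B ⊖ 𝟙))) k n)))) ⟩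
  u - + 2 * d - + 2 * (d - + 2 * s)
    ≡⟨ cong (λ d → u - + 2 * d - + 2 * (d - + 2 * s))
         (trans (t^x^-cong 0 1 nonempty-equation k n)
                (trans (t^x^-⊕ 0 1 (W₀ ⊖ t^ 0 x^ 1 · 𝟙) (t^ 0 x^ 1 · ((B ⊖ 𝟙) ⊛ (B ⊖ 𝟙))) k n)
                       (cong (_+ s) (t^x^-⊖ 0 1 W₀ (t^ 0 x^ 1 · 𝟙) k n)))) ⟩
  u - + 2 * ((w - o) + s) - + 2 * (((w - o) + s) - + 2 * s)
    ≡⟨ simplify u w o s ⟩
  u + + 4 * (o - w)
    ≡⟨ cong (_+_ u) (sym (trans (scaled-monomial-⊛ (+ 4) 0 1 (𝕩 ⊖ W₀) k n)
         (cong (+ 4 *_) (trans (t^x^-⊖ 0 1 𝕩 W₀ k n) (cong (_- w) (t^x^-cong 0 1 (monomial-shift 0 1) k n)))))) ⟩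
  (𝟙 ⊕ const (+ 4) ⊛ 𝕩 ⊛ (𝕩 ⊖ W₀)) k n
    ∎
  where
  open ≡-Reasoning
  x· : PS → ℤ
  x· f = (t^ 0 x^ 1 · f) k n
  u = 𝟙 k n
  d = x· (B ⊖ 𝟙)
  w = x· W₀
  o = x· (t^ 0 x^ 1 · 𝟙)
  s = x· (t^ 0 x^ 1 · ((B ⊖ 𝟙) ⊛ (B ⊖ 𝟙)))
  simplify : ∀ u w o s → u - + 2 * ((w - o) + s) - + 2 * (((w - o) + s) - + 2 * s) ≡ u + + 4 * (o - w)
  simplify = solve-∀

unit-sum≢0 : ∀ {a b : ℤ} → a ≡ + 1 → b ≡ + 1 → a + b ≢ + 0
unit-sum≢0 refl refl ()

R-unique : ∀ Q W R′ →
  Q ⊛ Q ≈ 𝟙 ⊖ const (+ 4) ⊛ 𝕥 ⊛ 𝕩 → Q 0 0 ≡ + 1 → 𝕥 ⊛ W ≈ 𝟙 ⊖ Q →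
  R′ ⊛ R′ ≈ 𝟙 ⊕ const (+ 4) ⊛ 𝕩 ⊛ (𝕩 ⊖ W) → R′ 0 0 ≡ + 1 → R′ ≈ R₀
R-unique Q W R′ Q-square Q-unit 𝕥W R′-square R′-unit = R′≈R₀
  where
  Q≈Q₀ : Q ≈ Q₀
  Q≈Q₀ = square-root-unique (λ k n → trans (Q-square k n) (sym (Q₀-square k n))) (unit-sum≢0 Q-unit refl)
  W≈W₀ : W ≈ W₀
  W≈W₀ = 𝕥-⊛-injective (λ k n → trans (𝕥W k n) (trans (cong (_-_ (𝟙 k n)) (Q≈Q₀ k n)) (sym (W₀-equation k n))))
  R′≈R₀ : R′ ≈ R₀
  R′≈R₀ = square-root-unique (λ k n → trans (R′-square k n) (trans
    (cong (_+_ (𝟙 k n)) (⊛-congˡ (const (+ 4) ⊛ 𝕩) (λ i j → cong (_-_ (𝕩 i j)) (W≈W₀ i j)) k n))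
    (sym (R₀-square k n)))) (unit-sum≢0 R′-unit refl)

twice-x-nonempty : const (+ 2) ⊛ 𝕩 ⊛ (B ⊖ 𝟙) ≈ 𝟙 ⊖ R₀
twice-x-nonempty k n =
  trans (scaled-monomial-⊛ (+ 2) 0 1 (B ⊖ 𝟙) k n) (i≡j-[j-i] (+ 2 * (t^ 0 x^ 1 · (B ⊖ 𝟙)) k n) (𝟙 k n))

theorem4p1 :
    (Σ PS λ Q → Σ PS λ W → Σ PS λ R →
        (Q ⊛ Q ≈ 𝟙 ⊖ const (+ 4) ⊛ 𝕥 ⊛ 𝕩) × (Q 0 0 ≡ + 1)
      × (𝕥 ⊛ W ≈ 𝟙 ⊖ Q)
      × (R ⊛ R ≈ 𝟙 ⊕ const (+ 4) ⊛ 𝕩 ⊛ (𝕩 ⊖ W)) × (R 0 0 ≡ + 1))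
    ×
    ((Q W R : PS) →
        Q ⊛ Q ≈ 𝟙 ⊖ const (+ 4) ⊛ 𝕥 ⊛ 𝕩 → (Q 0 0 ≡ + 1) →
        𝕥 ⊛ W ≈ 𝟙 ⊖ Q →
        R ⊛ R ≈ 𝟙 ⊕ const (+ 4) ⊛ 𝕩 ⊛ (𝕩 ⊖ W) → (R 0 0 ≡ + 1) →
        const (+ 2) ⊛ 𝕩 ⊛ (B ⊖ 𝟙) ≈ 𝟙 ⊖ R)
theorem4p1 = (Q₀ , W₀ , R₀ , Q₀-square , refl , W₀-equation , R₀-square , refl)
           , λ Q W R′ Q-square Q-unit 𝕥W R′-square R′-unit k n → trans (twice-x-nonempty k n)
               (cong (_-_ (𝟙 k n)) (sym (R-unique Q W R′ Q-square Q-unit 𝕥W R′-square R′-unit k n)))
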